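{- The prechart $\mathrm{SExp}$ of $1$-free star expressions is well-layered.
   Context: Fix a finite set $A$ of actions. A prechart is $(X,\langle o,\partial\rangle)$ with $o\colon X\to 2^A$, $\partial\colon X\to\mathcal P_\omega(X)^A$ ($\mathcal P_\omega$ = finite subsets); $x\Rightarrow a$ means $o(x)(a)=1$ and $x\xrightarrow{a}y$ means $y\in\partial(x)(a)$. $\mathrm{SExp}$ is generated by $e,f::=a\in A\mid 0\mid e+f\mid ef\mid e*f$, with outputs/transitions exactly those derivable by: $a\Rightarrow a$; if $e_i\Rightarrow a$ then $e_1+e_2\Rightarrow a$; if $e_i\xrightarrow{a}f$ then $e_1+e_2\xrightarrow{a}f$; if $e_1\Rightarrow a$ then $e_1e_2\xrightarrow{a}e_2$; if $e_1\xrightarrow{a}f$ then $e_1e_2\xrightarrow{a}fe_2$; if $e_2\Rightarrow a$ then $e_1*e_2\Rightarrow a$; if $e_2\xrightarrow{a}f$ then $e_1*e_2\xrightarrow{a}f$; if $e_1\xrightarrow{a}f$ then $e_1*e_2\xrightarrow{a}f(e_1*e_2)$; if $e_1\Rightarrow a$ then $e_1*e_2\xrightarrow{a}e_1*e_2$. A transition system with output is $(X,\langle o,\partial\rangle)$ with $o\colon X\to 2$, $\partial\colon X\to\mathcal P_\omega(X)$; write $x\Rightarrow$ if $o(x)=1$ and $x\to y$ if $y\in\partial(x)$. The underlying transition system of a prechart has $o(x)=1$ iff $x\Rightarrow a$ for some $a$, and $\partial(x)=\bigcup_{a\in A}\partial(x)(a)$. An entry/body labelling of a transition system $(X,\langle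 o,\partial\rangle)$ is a map $\partial^\bullet\colon X\to\mathcal P_\omega(\{\mathsf e,\mathsf b\}\times X)$ with $\partial(x)=\{y\mid(\mathsf e,y)\in\partial^\bullet(x)\text{ or }(\mathsf b,y)\in\partial^\bullet(x)\}$ (same outputs). Write $x\to_{\mathsf e}y$ if $(\mathsf e,y)\in\partial^\bullet(x)$ and $x\to_{\mathsf b}y$ if $(\mathsf b,y)\in\partial^\bullet(x)$. Write $x\curvearrowright y$ if there are $n\ge1$ and $v_1,\dots,v_n$ with $v_n=y$, $x\to_{\mathsf e}v_1\to_{\mathsf b}v_2\to_{\mathsf b}\cdots\to_{\mathsf b}v_n$ and $x\notin\{v_1,\dots,v_n\}$. $R^+$, $R^*$ denote transitive and reflexive-transitive closures. A layering witness is an entry/body labelling that is (1) locally finite: the set of states reachable from each $x$ is finite; (2) flat: $x\to_{\mathsf e}y$ implies not $x\to_{\mathsf b}y$; (3) fully specified: for all $x$, not $x\to_{\mathsf b}^+x$, and if $x\to_{\mathsf e}y$ with $y\ne x$ then $y\to^+x$; (4) layered: the directed graph $(X,\curvearrowright)$ is acyclic; (5) goto-free: $x\curvearrowright y$ implies not $y\Rightarrow$. A transition system is well-layered if it has a layering witness; a prechart is well-layered if its underlying transition system is. -}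

module Defs where

open import Data.Fin using (Fin)
open import Data.Nat using (ℕ)
open import Data.List using (List)
open import Data.List.Membership.Propositional using (_∈_)
open import Data.Product using (Σ; ∃; _×_; _,_)
open import Data.Sum using (_⊎_)
open import Data.Empty using (⊥)
open import Relation.Nullary using (¬_)
open import Relation.Binary.PropositionalEquality using (_≡_; _≢_)
open import Relation.Binary.Construct.Closure.Transitive using (TransClosure)
open import Relation.Binary.Construct.Closure.ReflexiveTransitive using (Star)
open import Function.Bundles using (_⇔_)

-- Transition systems with output (relational presentation):
-- out x  means  x ⇒  (o(x) = 1),   x ⟶ y  means  y ∈ ∂(x).

record TS : Set₁ where
  field
    X    : Set
    out  : X → Set
    _⟶_  : X → X → Set

data Lab : Set where
  𝖾 𝖻 : Lab

-- An entry/body labelling ∂• : X → P_ω({e,b} × X), finite sets as lists,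
-- whose underlying transitions are exactly those of the system.
record Labelling (T : TS) : Set where
  open TS T
  field
    ∂•       : X → List (Lab × X)
    matches  : ∀ x y → (x ⟶ y) ⇔ (((𝖾 , y) ∈ ∂• x) ⊎ ((𝖻 , y) ∈ ∂• x))

module _ {T : TS} (L : Labelling T) where
  open TS T
  open Labelling L

  _⟶e_ : X → X → Set
  x ⟶e y = (𝖾 , y) ∈ ∂• x

  _⟶b_ : X → X → Set
  x ⟶b y = (𝖻 , y) ∈ ∂• x

  data BodyAvoid (x : X) : X → X → Set where
    here  : ∀ {v} → BodyAvoid x v v
    there : ∀ {v w u} → v ⟶b w → w ≢ x → BodyAvoid x w u → BodyAvoid x v u

  _↷_ : X → X → Set
  x ↷ y = ∃ λ v₁ → (x ⟶e v₁) × (v₁ ≢ x) × BodyAvoid x v₁ y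

  record IsLayeringWitness : Set where
    field
      locallyFinite : ∀ x → ∃ λ (ys : List X) → ∀ y → Star _⟶_ x y → y ∈ ys
      flat          : ∀ x y → x ⟶e y → ¬ (x ⟶b y)
      noBodyCycle   : ∀ x → ¬ TransClosure _⟶b_ x x
      entryReturns  : ∀ x y → x ⟶e y → y ≢ x → TransClosure _⟶_ y x
      layered       : ∀ x → ¬ TransClosure _↷_ x x
      gotoFree      : ∀ x y → x ↷ y → ¬ out y

WellLayered : TS → Set
WellLayered T = Σ (Labelling T) IsLayeringWitness


data SExp (n : ℕ) : Set where
  act  : Fin n → SExp n
  𝟘    : SExp n
  _⊕_  : SExp n → SExp n → SExp n
  _⊙_  : SExp n → SExp n → SExp n
  _⊛_  : SExp n → SExp n → SExp n

infixl 6 _⊕_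
infixl 7 _⊙_
infixl 8 _⊛_

data _⇒_ {n} : SExp n → Fin n → Set where
  act⇒  : ∀ {a} → act a ⇒ a
  +⇒ˡ   : ∀ {e₁ e₂ a} → e₁ ⇒ a → (e₁ ⊕ e₂) ⇒ a
  +⇒ʳ   : ∀ {e₁ e₂ a} → e₂ ⇒ a → (e₁ ⊕ e₂) ⇒ a
  *⇒    : ∀ {e₁ e₂ a} → e₂ ⇒ a → (e₁ ⊛ e₂) ⇒ a

data _—[_]→_ {n} : SExp n → Fin n → SExp n → Set where
  +→ˡ   : ∀ {e₁ e₂ a f} → e₁ —[ a ]→ f → (e₁ ⊕ e₂) —[ a ]→ f
  +→ʳ   : ∀ {e₁ e₂ a f} → e₂ —[ a ]→ f → (e₁ ⊕ e₂) —[ a ]→ f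
  ·⇒→   : ∀ {e₁ e₂ a} → e₁ ⇒ a → (e₁ ⊙ e₂) —[ a ]→ e₂
  ·→    : ∀ {e₁ e₂ a f} → e₁ —[ a ]→ f → (e₁ ⊙ e₂) —[ a ]→ (f ⊙ e₂)
  *→ʳ   : ∀ {e₁ e₂ a f} → e₂ —[ a ]→ f → (e₁ ⊛ e₂) —[ a ]→ f
  *→ˡ   : ∀ {e₁ e₂ a f} → e₁ —[ a ]→ f → (e₁ ⊛ e₂) —[ a ]→ (f ⊙ (e₁ ⊛ e₂))
  *⇒→   : ∀ {e₁ e₂ a} → e₁ ⇒ a → (e₁ ⊛ e₂) —[ a ]→ (e₁ ⊛ e₂)

SExpTS : (n : ℕ) → TS
SExpTS n = record
  { X   = SExp n
  ; out = λ e → ∃ λ (a : Fin n) → e ⇒ a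
  ; _⟶_ = λ e f → ∃ λ (a : Fin n) → e —[ a ]→ f
  }

{-# OPTIONS --safe #-}

-- A transition is labelled an entry exactly when it is a loop step of a star
-- e₁ * e₂ (under some left context _ · h) that can come back: the self-loop
-- e₁ * e₂ → e₁ * e₂, or e₁ * e₂ → f (e₁ * e₂) with f normed, i.e. able to reach
-- an output.  All other transitions are body transitions.  Body transitions
-- strictly decrease a potential, so there are no body cycles.  Starting an
-- iteration f (e₁ * e₂) of the loop and then avoiding e₁ * e₂ keeps the
-- leftmost factor a derivative of e₁, so ↷ strictly shrinks the leftmost factor
-- and always ends in a sequential composition, which has no output.  Local
-- finiteness holds because every reachable state is a syntactic derivative.

module Submission where

open import Data.Nat using (ℕ; suc; _+_; _≤_; _<_; s≤s)
open import Data.Nat.Properties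
  using (≤-refl; ≤-trans; <-trans; <-irrefl; m≤m+n; m≤n+m; m≤n⇒m≤1+n; +-mono-≤; +-monoˡ-<; module ≤-Reasoning)
open import Data.Bool using (Bool; true; false; T; T?; if_then_else_; _∧_; _∨_)
open import Data.Bool.Properties using (T-∧; T-∨; T-≡)
open import Data.Fin using (Fin)
open import Data.List using (List; []; _∷_; _++_; map)
open import Data.List.Membership.Propositional using (_∈_)
open import Data.List.Membership.Propositional.Properties using (∈-map⁺; ∈-map⁻; ∈-++⁺ˡ; ∈-++⁺ʳ; ∈-++⁻)
import Data.List.Relation.Unary.Any as Any
open import Data.Product using (∃; _×_; _,_; proj₂; map₁; map₂; map₂′)
open import Data.Sum using (_⊎_; inj₁; inj₂)
open import Data.Empty using (⊥-elim)
open import Function using (_∘_; const; id)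
open import Function.Bundles using (Equivalence; mk⇔)
open import Relation.Nullary using (¬_; yes; no)
open import Relation.Binary.PropositionalEquality using (_≡_; _≢_; refl; cong; subst)
open import Relation.Binary.Construct.Closure.Transitive using (TransClosure; [_]; _∷_)
open import Relation.Binary.Construct.Closure.ReflexiveTransitive using (Star; ε; _◅_; _◅◅_; gmap)
open import Defs

open Equivalence using (to; from)

module _ {A : Set} {R : A → A → Set} where

  ⁺-decreasing : (μ : A → ℕ) → (∀ {x y} → R x y → μ y < μ x) →
                 ∀ {x y} → TransClosure R x y → μ y < μ x
  ⁺-decreasing μ dec [ r ]    = dec r
  ⁺-decreasing μ dec (r ∷ rs) = <-trans (⁺-decreasing μ dec rs) (dec r)

  decreasing⇒acyclic : (μ : A → ℕ) → (∀ {x y} → R x y → μ y < μ x) →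
                       ∀ x → ¬ TransClosure R x x
  decreasing⇒acyclic μ dec x cycle = <-irrefl refl (⁺-decreasing μ dec cycle)

  star-∷ʳ : ∀ {x y z} → Star R x y → R y z → TransClosure R x z
  star-∷ʳ ε        r′ = [ r′ ]
  star-∷ʳ (r ◅ rs) r′ = r ∷ star-∷ʳ rs r′

module _ {A : Set} where

  singletonIf : Bool → A → List A
  singletonIf b x = if b then x ∷ [] else []

  ∈-singletonIf⁺ : ∀ {b} {x : A} → T b → x ∈ singletonIf b x
  ∈-singletonIf⁺ {true} _ = Any.here refl

  ∈-singletonIf⁻ : ∀ {b} {x y : A} → y ∈ singletonIf b x → T b × y ≡ x
  ∈-singletonIf⁻ {true} (Any.here y≡x) = _ , y≡x

variable
  n  : ℕ
  a  : Fin n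
  l  : Lab
  e e₁ e₂ f g t y z : SExp n
  hs : List (SExp n)

_⟶_ : SExp n → SExp n → Set
e ⟶ f = ∃ λ a → e —[ a ]→ f

plug : SExp n → List (SExp n) → SExp n
plug t []       = t
plug t (h ∷ hs) = plug t hs ⊙ h

plug-step : ∀ hs → t —[ a ]→ f → plug t hs —[ a ]→ plug f hs
plug-step []       s = s
plug-step (_ ∷ hs) s = ·→ (plug-step hs s)

plug-star : ∀ hs → Star _⟶_ t f → Star _⟶_ (plug t hs) (plug f hs)
plug-star hs = gmap (λ t → plug t hs) (map₂ (plug-step hs))

plug-noOutput : (∀ {a} → ¬ t ⇒ a) → ∀ hs → ¬ plug t hs ⇒ a
plug-noOutput t⇏ []      = t⇏
plug-noOutput t⇏ (_ ∷ _) ()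

plug-step⁻ : (∀ {a} → ¬ t ⇒ a) → ∀ hs → plug t hs —[ a ]→ z →
             ∃ λ f → (t —[ a ]→ f) × z ≡ plug f hs
plug-step⁻ t⇏ []       s       = _ , s , refl
plug-step⁻ t⇏ (_ ∷ hs) (·⇒→ o) = ⊥-elim (plug-noOutput t⇏ hs o)
plug-step⁻ t⇏ (_ ∷ hs) (·→ s) with plug-step⁻ t⇏ hs s
... | f , s′ , refl = f , s′ , refl

hasOutput : SExp n → Bool
hasOutput (act _)   = true
hasOutput 𝟘         = false
hasOutput (e₁ ⊕ e₂) = hasOutput e₁ ∨ hasOutput e₂
hasOutput (_ ⊙ _)   = false
hasOutput (_ ⊛ e₂)  = hasOutput e₂

hasOutput-complete : e ⇒ a → T (hasOutput e)
hasOutput-complete act⇒    = _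
hasOutput-complete (+⇒ˡ o) = from T-∨ (inj₁ (hasOutput-complete o))
hasOutput-complete (+⇒ʳ o) = from T-∨ (inj₂ (hasOutput-complete o))
hasOutput-complete (*⇒ o)  = hasOutput-complete o

hasOutput-sound : T (hasOutput e) → ∃ λ a → e ⇒ a
hasOutput-sound {e = act a}   _ = a , act⇒
hasOutput-sound {e = e₁ ⊕ e₂} o with to T-∨ o
... | inj₁ o₁ = map₂ +⇒ˡ (hasOutput-sound o₁)
... | inj₂ o₂ = map₂ +⇒ʳ (hasOutput-sound o₂)
hasOutput-sound {e = e₁ ⊛ e₂} o = map₂ *⇒ (hasOutput-sound o)

normed : SExp n → Bool
normed (act _)   = true
normed 𝟘         = false
normed (e₁ ⊕ e₂) = normed e₁ ∨ normed e₂
normed (e₁ ⊙ e₂) = normed e₁ ∧ normed e₂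
normed (_ ⊛ e₂)  = normed e₂

hasOutput⇒normed : T (hasOutput e) → T (normed e)
hasOutput⇒normed {e = act _}   _ = _
hasOutput⇒normed {e = e₁ ⊕ e₂} o with to (T-∨ {hasOutput e₁}) o
... | inj₁ o₁ = from T-∨ (inj₁ (hasOutput⇒normed {e = e₁} o₁))
... | inj₂ o₂ = from T-∨ (inj₂ (hasOutput⇒normed {e = e₂} o₂))
hasOutput⇒normed {e = _ ⊛ e₂}  o = hasOutput⇒normed {e = e₂} o

normed-backward : e —[ a ]→ f → T (normed f) → T (normed e)
normed-backward (+→ˡ s) nf = from T-∨ (inj₁ (normed-backward s nf))
normed-backward (+→ʳ s) nf = from T-∨ (inj₂ (normed-backward s nf))
normed-backward {e = e₁ ⊙ _} (·⇒→ o) nf = from T-∧ (hasOutput⇒normed {e = e₁} (hasOutput-complete o) , nf)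
normed-backward (·→ {f = f} s) nf = from T-∧ (map₁ (normed-backward s) (to (T-∧ {normed f}) nf))
normed-backward (*→ʳ s) nf = normed-backward s nf
normed-backward (*→ˡ s) nf = proj₂ (to T-∧ nf)
normed-backward (*⇒→ _) nf = nf

stuck-forward : ¬ T (normed e) → e —[ a ]→ f → ¬ T (normed f)
stuck-forward ¬ne s = ¬ne ∘ normed-backward s

ReachesOutput : SExp n → Set
ReachesOutput e = ∃ λ g → Star _⟶_ e g × T (hasOutput g)

reachesOutput-lift : (∀ {a f} → e₁ —[ a ]→ f → e —[ a ]→ f) → (T (hasOutput e₁) → T (hasOutput e)) →
                     ReachesOutput e₁ → ReachesOutput e
reachesOutput-lift _    out (_ , ε , o)            = _ , ε , out o
reachesOutput-lift step _   (g , (a , s) ◅ ss , o) = g , (a , step s) ◅ ss , o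

normed⇒reachesOutput : T (normed e) → ReachesOutput e
normed⇒reachesOutput {e = act _}   _ = _ , ε , _
normed⇒reachesOutput {e = e₁ ⊕ e₂} ne with to T-∨ ne
... | inj₁ ne₁ = reachesOutput-lift +→ˡ (from T-∨ ∘ inj₁) (normed⇒reachesOutput ne₁)
... | inj₂ ne₂ = reachesOutput-lift +→ʳ (from T-∨ ∘ inj₂) (normed⇒reachesOutput ne₂)
normed⇒reachesOutput {e = e₁ ⊙ e₂} ne with to T-∧ ne
... | ne₁ , ne₂ with normed⇒reachesOutput ne₁ | normed⇒reachesOutput ne₂
... | g₁ , ss₁ , o₁ | g₂ , ss₂ , o₂ =
  g₂ , plug-star (e₂ ∷ []) ss₁ ◅◅ map₂ ·⇒→ (hasOutput-sound o₁) ◅ ss₂ , o₂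
normed⇒reachesOutput {e = e₁ ⊛ e₂} ne = reachesOutput-lift *→ʳ id (normed⇒reachesOutput ne)

infix 4 _—⟨_⟩→_

data _—⟨_⟩→_ {n} : SExp n → Lab → SExp n → Set where
  +ˡ        : e₁ —⟨ l ⟩→ f → e₁ ⊕ e₂ —⟨ 𝖻 ⟩→ f
  +ʳ        : e₂ —⟨ l ⟩→ f → e₁ ⊕ e₂ —⟨ 𝖻 ⟩→ f
  ·⇒        : T (hasOutput e₁) → e₁ ⊙ e₂ —⟨ 𝖻 ⟩→ e₂
  ·→        : e₁ —⟨ l ⟩→ f → e₁ ⊙ e₂ —⟨ l ⟩→ f ⊙ e₂
  *ʳ        : e₂ —⟨ l ⟩→ f → e₁ ⊛ e₂ —⟨ 𝖻 ⟩→ f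
  *ˡ-normed : e₁ —⟨ l ⟩→ f → T (normed f) → e₁ ⊛ e₂ —⟨ 𝖾 ⟩→ f ⊙ (e₁ ⊛ e₂)
  *ˡ-stuck  : e₁ —⟨ l ⟩→ f → ¬ T (normed f) → e₁ ⊛ e₂ —⟨ 𝖻 ⟩→ f ⊙ (e₁ ⊛ e₂)
  *⇒        : T (hasOutput e₁) → e₁ ⊛ e₂ —⟨ 𝖾 ⟩→ e₁ ⊛ e₂

unlabel : e —⟨ l ⟩→ f → e ⟶ f
unlabel (+ˡ p)           = map₂ +→ˡ (unlabel p)
unlabel (+ʳ p)           = map₂ +→ʳ (unlabel p)
unlabel (·⇒ o)           = map₂ ·⇒→ (hasOutput-sound o)
unlabel (·→ p)           = map₂ ·→ (unlabel p)
unlabel (*ʳ p)           = map₂ *→ʳ (unlabel p)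
unlabel (*ˡ-normed p _)  = map₂ *→ˡ (unlabel p)
unlabel (*ˡ-stuck p _)   = map₂ *→ˡ (unlabel p)
unlabel (*⇒ o)           = map₂ *⇒→ (hasOutput-sound o)

label : e —[ a ]→ f → ∃ λ l → e —⟨ l ⟩→ f
label (+→ˡ s)            = 𝖻 , +ˡ (proj₂ (label s))
label (+→ʳ s)            = 𝖻 , +ʳ (proj₂ (label s))
label (·⇒→ o)            = 𝖻 , ·⇒ (hasOutput-complete o)
label (·→ s)             = map₂ ·→ (label s)
label (*→ʳ s)            = 𝖻 , *ʳ (proj₂ (label s))
label (*→ˡ {f = f} s) with T? (normed f)
... | yes nf             = 𝖾 , *ˡ-normed (proj₂ (label s)) nf
... | no ¬nf             = 𝖻 , *ˡ-stuck (proj₂ (label s)) ¬nf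
label (*⇒→ o)            = 𝖾 , *⇒ (hasOutput-complete o)

loopLabel : SExp n → Lab
loopLabel f = if normed f then 𝖾 else 𝖻

loopLabel-normed : T (normed f) → loopLabel f ≡ 𝖾
loopLabel-normed {f = f} nf with normed f
... | true = refl

loopLabel-stuck : ¬ T (normed f) → loopLabel f ≡ 𝖻
loopLabel-stuck {f = f} ¬nf with normed f
... | true  = ⊥-elim (¬nf _)
... | false = refl

*ˡ : e₁ —⟨ l ⟩→ f → e₁ ⊛ e₂ —⟨ loopLabel f ⟩→ f ⊙ (e₁ ⊛ e₂)
*ˡ {f = f} p with normed f in nf
... | true  = *ˡ-normed p (from T-≡ nf)
... | false = *ˡ-stuck p (subst T nf)

asBody : Lab × SExp n → Lab × SExp n
asBody = map₁ (const 𝖻)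

iterate : SExp n → Lab × SExp n → Lab × SExp n
iterate s (_ , f) = loopLabel f , f ⊙ s

labelledSteps : SExp n → List (Lab × SExp n)
labelledSteps (act _)   = []
labelledSteps 𝟘         = []
labelledSteps (e₁ ⊕ e₂) = map asBody (labelledSteps e₁ ++ labelledSteps e₂)
labelledSteps (e₁ ⊙ e₂) = singletonIf (hasOutput e₁) (𝖻 , e₂) ++ map (map₂′ (_⊙ e₂)) (labelledSteps e₁)
labelledSteps (e₁ ⊛ e₂) = map asBody (labelledSteps e₂)
                       ++ map (iterate (e₁ ⊛ e₂)) (labelledSteps e₁)
                       ++ singletonIf (hasOutput e₁) (𝖾 , e₁ ⊛ e₂)

∈-labelledSteps-iterate : ∀ {l′} → loopLabel f ≡ l′ → (l , f) ∈ labelledSteps e₁ →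
                          (l′ , f ⊙ (e₁ ⊛ e₂)) ∈ labelledSteps (e₁ ⊛ e₂)
∈-labelledSteps-iterate {e₁ = e₁} {e₂ = e₂} refl m =
  ∈-++⁺ʳ (map asBody (labelledSteps e₂)) (∈-++⁺ˡ (∈-map⁺ (iterate (e₁ ⊛ e₂)) m))

∈-labelledSteps⁺ : e —⟨ l ⟩→ f → (l , f) ∈ labelledSteps e
∈-labelledSteps⁺ (+ˡ p) = ∈-map⁺ asBody (∈-++⁺ˡ (∈-labelledSteps⁺ p))
∈-labelledSteps⁺ {e = e₁ ⊕ _} (+ʳ p) = ∈-map⁺ asBody (∈-++⁺ʳ (labelledSteps e₁) (∈-labelledSteps⁺ p))
∈-labelledSteps⁺ (·⇒ o) = ∈-++⁺ˡ (∈-singletonIf⁺ o)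
∈-labelledSteps⁺ {e = e₁ ⊙ e₂} (·→ p) =
  ∈-++⁺ʳ (singletonIf (hasOutput e₁) _) (∈-map⁺ (map₂′ (_⊙ e₂)) (∈-labelledSteps⁺ p))
∈-labelledSteps⁺ (*ʳ p) = ∈-++⁺ˡ (∈-map⁺ asBody (∈-labelledSteps⁺ p))
∈-labelledSteps⁺ (*ˡ-normed {f = f} p nf) =
  ∈-labelledSteps-iterate (loopLabel-normed {f = f} nf) (∈-labelledSteps⁺ p)
∈-labelledSteps⁺ (*ˡ-stuck {f = f} p ¬nf) =
  ∈-labelledSteps-iterate (loopLabel-stuck {f = f} ¬nf) (∈-labelledSteps⁺ p)
∈-labelledSteps⁺ {e = e₁ ⊛ e₂} (*⇒ o) =
  ∈-++⁺ʳ (map asBody (labelledSteps e₂)) (∈-++⁺ʳ (map (iterate (e₁ ⊛ e₂)) (labelledSteps e₁)) (∈-singletonIf⁺ o))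

∈-labelledSteps⁻ : ∀ e → (l , f) ∈ labelledSteps e → e —⟨ l ⟩→ f
∈-labelledSteps⁻ (e₁ ⊕ e₂) m with ∈-map⁻ asBody m
... | _ , m′ , refl with ∈-++⁻ (labelledSteps e₁) m′
...   | inj₁ m₁ = +ˡ (∈-labelledSteps⁻ e₁ m₁)
...   | inj₂ m₂ = +ʳ (∈-labelledSteps⁻ e₂ m₂)
∈-labelledSteps⁻ (e₁ ⊙ e₂) m with ∈-++⁻ (singletonIf (hasOutput e₁) _) m
... | inj₁ m₁ with ∈-singletonIf⁻ m₁
...   | o , refl = ·⇒ o
∈-labelledSteps⁻ (e₁ ⊙ e₂) m | inj₂ m₂ with ∈-map⁻ (map₂′ (_⊙ e₂)) m₂
...   | _ , m′ , refl = ·→ (∈-labelledSteps⁻ e₁ m′)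
∈-labelledSteps⁻ (e₁ ⊛ e₂) m with ∈-++⁻ (map asBody (labelledSteps e₂)) m
... | inj₁ m₁ with ∈-map⁻ asBody m₁
...   | _ , m′ , refl = *ʳ (∈-labelledSteps⁻ e₂ m′)
∈-labelledSteps⁻ (e₁ ⊛ e₂) m | inj₂ m₂ with ∈-++⁻ (map (iterate (e₁ ⊛ e₂)) (labelledSteps e₁)) m₂
...   | inj₁ m₃ with ∈-map⁻ (iterate (e₁ ⊛ e₂)) m₃
...     | _ , m′ , refl = *ˡ (∈-labelledSteps⁻ e₁ m′)
∈-labelledSteps⁻ (e₁ ⊛ e₂) m | inj₂ m₂ | inj₂ m₃ with ∈-singletonIf⁻ m₃
...     | o , refl = *⇒ o

labelling : Labelling (SExpTS n)
labelling = record
  { ∂•      = labelledSteps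
  ; matches = λ e f → mk⇔ (toLabelled ∘ proj₂) fromLabelled
  }
  where
  fromLabelled : ((𝖾 , f) ∈ labelledSteps e) ⊎ ((𝖻 , f) ∈ labelledSteps e) → e ⟶ f
  fromLabelled (inj₁ m) = unlabel (∈-labelledSteps⁻ _ m)
  fromLabelled (inj₂ m) = unlabel (∈-labelledSteps⁻ _ m)

  toLabelled : e —[ a ]→ f → ((𝖾 , f) ∈ labelledSteps e) ⊎ ((𝖻 , f) ∈ labelledSteps e)
  toLabelled s with label s
  ... | 𝖾 , p = inj₁ (∈-labelledSteps⁺ p)
  ... | 𝖻 , p = inj₂ (∈-labelledSteps⁺ p)

data Derivative {n} : SExp n → SExp n → Set where
  self : Derivative e e
  ⊕ˡ   : Derivative e₁ y → Derivative (e₁ ⊕ e₂) y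
  ⊕ʳ   : Derivative e₂ y → Derivative (e₁ ⊕ e₂) y
  ⊙ˡ   : Derivative e₁ f → Derivative (e₁ ⊙ e₂) (f ⊙ e₂)
  ⊙ʳ   : Derivative e₂ y → Derivative (e₁ ⊙ e₂) y
  ⊛ˡ   : Derivative e₁ f → Derivative (e₁ ⊛ e₂) (f ⊙ (e₁ ⊛ e₂))
  ⊛ʳ   : Derivative e₂ y → Derivative (e₁ ⊛ e₂) y

derivatives : SExp n → List (SExp n)
innerDerivatives : SExp n → List (SExp n)

derivatives e = e ∷ innerDerivatives e

innerDerivatives (act _)     = []
innerDerivatives 𝟘           = []
innerDerivatives (e₁ ⊕ e₂)   = derivatives e₁ ++ derivatives e₂
innerDerivatives (e₁ ⊙ e₂)   = map (_⊙ e₂) (derivatives e₁) ++ derivatives e₂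
innerDerivatives e@(e₁ ⊛ e₂) = map (_⊙ e) (derivatives e₁) ++ derivatives e₂

Derivative⇒∈ : Derivative e y → y ∈ derivatives e
Derivative⇒∈                  self   = Any.here refl
Derivative⇒∈                  (⊕ˡ d) = Any.there (∈-++⁺ˡ (Derivative⇒∈ d))
Derivative⇒∈ {e = e₁ ⊕ _}     (⊕ʳ d) = Any.there (∈-++⁺ʳ (derivatives e₁) (Derivative⇒∈ d))
Derivative⇒∈ {e = _ ⊙ e₂}     (⊙ˡ d) = Any.there (∈-++⁺ˡ (∈-map⁺ (_⊙ e₂) (Derivative⇒∈ d)))
Derivative⇒∈ {e = e₁ ⊙ e₂}    (⊙ʳ d) = Any.there (∈-++⁺ʳ (map (_⊙ e₂) (derivatives e₁)) (Derivative⇒∈ d))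
Derivative⇒∈ {e = e}          (⊛ˡ d) = Any.there (∈-++⁺ˡ (∈-map⁺ (_⊙ e) (Derivative⇒∈ d)))
Derivative⇒∈ {e = e@(e₁ ⊛ _)} (⊛ʳ d) = Any.there (∈-++⁺ʳ (map (_⊙ e) (derivatives e₁)) (Derivative⇒∈ d))

step⇒Derivative : e —[ a ]→ f → Derivative e f
step⇒Derivative (+→ˡ s) = ⊕ˡ (step⇒Derivative s)
step⇒Derivative (+→ʳ s) = ⊕ʳ (step⇒Derivative s)
step⇒Derivative (·⇒→ _) = ⊙ʳ self
step⇒Derivative (·→ s)  = ⊙ˡ (step⇒Derivative s)
step⇒Derivative (*→ʳ s) = ⊛ʳ (step⇒Derivative s)
step⇒Derivative (*→ˡ s) = ⊛ˡ (step⇒Derivative s)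
step⇒Derivative (*⇒→ _) = self

Derivative-step : Derivative e y → y —[ a ]→ z → Derivative e z
Derivative-step self   s       = step⇒Derivative s
Derivative-step (⊕ˡ d) s       = ⊕ˡ (Derivative-step d s)
Derivative-step (⊕ʳ d) s       = ⊕ʳ (Derivative-step d s)
Derivative-step (⊙ˡ d) (·⇒→ _) = ⊙ʳ self
Derivative-step (⊙ˡ d) (·→ s)  = ⊙ˡ (Derivative-step d s)
Derivative-step (⊙ʳ d) s       = ⊙ʳ (Derivative-step d s)
Derivative-step (⊛ˡ d) (·⇒→ _) = self
Derivative-step (⊛ˡ d) (·→ s)  = ⊛ˡ (Derivative-step d s)
Derivative-step (⊛ʳ d) s       = ⊛ʳ (Derivative-step d s)

Derivative-star : Derivative e y → Star _⟶_ y z → Derivative e z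
Derivative-star d ε              = d
Derivative-star d ((_ , s) ◅ ss) = Derivative-star (Derivative-step d s) ss

labelled⇒Derivative : e —⟨ l ⟩→ f → Derivative e f
labelled⇒Derivative = step⇒Derivative ∘ proj₂ ∘ unlabel

size : SExp n → ℕ
size (act _)   = 1
size 𝟘         = 1
size (e₁ ⊕ e₂) = suc (size e₁ + size e₂)
size (e₁ ⊙ e₂) = suc (size e₁ + size e₂)
size (e₁ ⊛ e₂) = suc (size e₁ + size e₂)

headFactor : SExp n → SExp n
headFactor (e₁ ⊙ _) = headFactor e₁
headFactor e        = e

lastFactor : SExp n → SExp n
lastFactor (_ ⊙ e₂) = lastFactor e₂
lastFactor e        = e

≤-suc-+ˡ : ∀ m k → m ≤ suc (m + k)
≤-suc-+ˡ m k = m≤n⇒m≤1+n (m≤m+n m k)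

≤-suc-+ʳ : ∀ m k → k ≤ suc (m + k)
≤-suc-+ʳ m k = m≤n⇒m≤1+n (m≤n+m k m)

size-headFactor : ∀ e → size (headFactor {n} e) ≤ size e
size-headFactor (e₁ ⊙ e₂) = ≤-trans (size-headFactor e₁) (≤-suc-+ˡ (size e₁) (size e₂))
size-headFactor (act _)   = ≤-refl
size-headFactor 𝟘         = ≤-refl
size-headFactor (_ ⊕ _)   = ≤-refl
size-headFactor (_ ⊛ _)   = ≤-refl

size-lastFactor : ∀ e → size (lastFactor {n} e) ≤ size e
size-lastFactor (e₁ ⊙ e₂) = ≤-trans (size-lastFactor e₂) (≤-suc-+ʳ (size e₁) (size e₂))
size-lastFactor (act _)   = ≤-refl
size-lastFactor 𝟘         = ≤-refl
size-lastFactor (_ ⊕ _)   = ≤-refl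
size-lastFactor (_ ⊛ _)   = ≤-refl

Derivative-headFactor : Derivative e y → size (headFactor y) ≤ size e
Derivative-headFactor {e = e} self = size-headFactor e
Derivative-headFactor {e = e₁ ⊕ e₂} (⊕ˡ d) = ≤-trans (Derivative-headFactor d) (≤-suc-+ˡ _ _)
Derivative-headFactor {e = e₁ ⊕ e₂} (⊕ʳ d) = ≤-trans (Derivative-headFactor d) (≤-suc-+ʳ _ _)
Derivative-headFactor {e = e₁ ⊙ e₂} (⊙ˡ d) = ≤-trans (Derivative-headFactor d) (≤-suc-+ˡ _ _)
Derivative-headFactor {e = e₁ ⊙ e₂} (⊙ʳ d) = ≤-trans (Derivative-headFactor d) (≤-suc-+ʳ _ _)
Derivative-headFactor {e = e₁ ⊛ e₂} (⊛ˡ d) = ≤-trans (Derivative-headFactor d) (≤-suc-+ˡ _ _)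
Derivative-headFactor {e = e₁ ⊛ e₂} (⊛ʳ d) = ≤-trans (Derivative-headFactor d) (≤-suc-+ʳ _ _)

Derivative-lastFactor : Derivative e y → size (lastFactor y) ≤ size e
Derivative-lastFactor {e = e} self = size-lastFactor e
Derivative-lastFactor {e = e₁ ⊕ e₂} (⊕ˡ d) = ≤-trans (Derivative-lastFactor d) (≤-suc-+ˡ _ _)
Derivative-lastFactor {e = e₁ ⊕ e₂} (⊕ʳ d) = ≤-trans (Derivative-lastFactor d) (≤-suc-+ʳ _ _)
Derivative-lastFactor {e = e₁ ⊙ e₂} (⊙ˡ d) = ≤-trans (size-lastFactor e₂) (≤-suc-+ʳ _ _)
Derivative-lastFactor {e = e₁ ⊙ e₂} (⊙ʳ d) = ≤-trans (Derivative-lastFactor d) (≤-suc-+ʳ _ _)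
Derivative-lastFactor {e = e₁ ⊛ e₂} (⊛ˡ d) = ≤-refl
Derivative-lastFactor {e = e₁ ⊛ e₂} (⊛ʳ d) = ≤-trans (Derivative-lastFactor d) (≤-suc-+ʳ _ _)

potentialBound : SExp n → ℕ
potentialBound (act _)   = 0
potentialBound 𝟘         = 0
potentialBound (e₁ ⊕ e₂) = suc (potentialBound e₁ + potentialBound e₂)
potentialBound (e₁ ⊙ e₂) = suc (potentialBound e₁ + potentialBound e₂)
potentialBound (e₁ ⊛ e₂) = suc (potentialBound e₁ + suc (potentialBound e₁ + potentialBound e₂))

-- A left factor that is not normed never passes control to its right factor,
-- which therefore does not count; this makes the stuck loop steps decrease.
potential : SExp n → ℕ
potential (act _)   = 0
potential 𝟘         = 0
potential (e₁ ⊕ e₂) = suc (potentialBound e₁ + potentialBound e₂)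
potential (e₁ ⊙ e₂) = if normed e₁ then suc (potential e₁ + potential e₂) else potential e₁
potential (e₁ ⊛ e₂) = suc (potentialBound e₁ + potentialBound e₂)

potential-⊙ : ∀ g h → potential {n} (g ⊙ h) ≤ suc (potential g + potential h)
potential-⊙ g h with normed g
... | true  = ≤-refl
... | false = ≤-suc-+ˡ (potential g) (potential h)

potential-⊙-normed : ∀ g h → T (normed g) → potential {n} (g ⊙ h) ≡ suc (potential g + potential h)
potential-⊙-normed g h ng with normed g
... | true = refl

potential-⊙-stuck : ∀ g h → ¬ T (normed g) → potential {n} (g ⊙ h) ≡ potential g
potential-⊙-stuck g h ¬ng with normed g
... | true  = ⊥-elim (¬ng _)
... | false = refl

potential≤potentialBound : ∀ e → potential {n} e ≤ potentialBound e
potential≤potentialBound (act _)   = ≤-refl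
potential≤potentialBound 𝟘         = ≤-refl
potential≤potentialBound (_ ⊕ _)   = ≤-refl
potential≤potentialBound (e₁ ⊙ e₂) = ≤-trans (potential-⊙ e₁ e₂)
  (s≤s (+-mono-≤ (potential≤potentialBound e₁) (potential≤potentialBound e₂)))
potential≤potentialBound (e₁ ⊛ e₂) = ≤-suc-+ʳ (potentialBound e₁) _

Derivative-potential : Derivative e y → potential y ≤ potentialBound e
Derivative-potential {e = e} self = potential≤potentialBound e
Derivative-potential (⊕ˡ d) = ≤-trans (Derivative-potential d) (≤-suc-+ˡ _ _)
Derivative-potential (⊕ʳ d) = ≤-trans (Derivative-potential d) (≤-suc-+ʳ _ _)
Derivative-potential {e = _ ⊙ e₂} (⊙ˡ {f = f} d) = ≤-trans (potential-⊙ f e₂)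
  (s≤s (+-mono-≤ (Derivative-potential d) (potential≤potentialBound e₂)))
Derivative-potential (⊙ʳ d) = ≤-trans (Derivative-potential d) (≤-suc-+ʳ _ _)
Derivative-potential {e = e} (⊛ˡ {f = f} d) = ≤-trans (potential-⊙ f e)
  (s≤s (+-mono-≤ (Derivative-potential d) ≤-refl))
Derivative-potential {e = e₁ ⊛ e₂} (⊛ʳ d) = ≤-trans (Derivative-potential d)
  (≤-trans (≤-suc-+ʳ (potentialBound e₁) (potentialBound e₂)) (≤-suc-+ʳ (potentialBound e₁) _))

potential-decreasing : e —⟨ 𝖻 ⟩→ f → potential f < potential e
potential-decreasing (+ˡ p) = s≤s (≤-trans (Derivative-potential (labelled⇒Derivative p)) (m≤m+n _ _))
potential-decreasing (+ʳ p) = s≤s (≤-trans (Derivative-potential (labelled⇒Derivative p)) (m≤n+m _ _))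
potential-decreasing {e = e₁ ⊙ e₂} (·⇒ o) = begin-strict
  potential e₂                        <⟨ s≤s (m≤n+m _ _) ⟩
  suc (potential e₁ + potential e₂)   ≡⟨ potential-⊙-normed e₁ e₂ (hasOutput⇒normed {e = e₁} o) ⟨
  potential (e₁ ⊙ e₂)                 ∎
  where open ≤-Reasoning
potential-decreasing {e = e₁ ⊙ e₂} (·→ {f = f} p) with T? (normed e₁)
... | yes ne₁ = begin-strict
  potential (f ⊙ e₂)                  ≤⟨ potential-⊙ f e₂ ⟩
  suc (potential f + potential e₂)    <⟨ s≤s (+-monoˡ-< (potential e₂) (potential-decreasing p)) ⟩
  suc (potential e₁ + potential e₂)   ≡⟨ potential-⊙-normed e₁ e₂ ne₁ ⟨
  potential (e₁ ⊙ e₂)                 ∎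
  where open ≤-Reasoning
... | no ¬ne₁ = begin-strict
  potential (f ⊙ e₂)                  ≡⟨ potential-⊙-stuck f e₂ (stuck-forward ¬ne₁ (proj₂ (unlabel p))) ⟩
  potential f                         <⟨ potential-decreasing p ⟩
  potential e₁                        ≡⟨ potential-⊙-stuck e₁ e₂ ¬ne₁ ⟨
  potential (e₁ ⊙ e₂)                 ∎
  where open ≤-Reasoning
potential-decreasing (*ʳ p) = s≤s (≤-trans (Derivative-potential (labelled⇒Derivative p)) (m≤n+m _ _))
potential-decreasing {e = e₁ ⊛ e₂} (*ˡ-stuck {f = f} p ¬nf) = begin-strict
  potential (f ⊙ (e₁ ⊛ e₂))           ≡⟨ potential-⊙-stuck f (e₁ ⊛ e₂) ¬nf ⟩
  potential f                         ≤⟨ Derivative-potential (labelled⇒Derivative p) ⟩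
  potentialBound e₁                   <⟨ s≤s (m≤m+n _ _) ⟩
  potential (e₁ ⊛ e₂)                 ∎
  where open ≤-Reasoning

data EntryStep {n} : SExp n → SExp n → Set where
  selfLoop  : ∀ hs → EntryStep (plug (e₁ ⊛ e₂) hs) (plug (e₁ ⊛ e₂) hs)
  loopEntry : ∀ hs → e₁ ⟶ f → T (normed f) → EntryStep (plug (e₁ ⊛ e₂) hs) (plug (f ⊙ (e₁ ⊛ e₂)) hs)

entryStep-view : e —⟨ 𝖾 ⟩→ f → EntryStep e f
entryStep-view (·→ {e₂ = h} p) with entryStep-view p
... | selfLoop hs         = selfLoop (h ∷ hs)
... | loopEntry hs s nf   = loopEntry (h ∷ hs) s nf
entryStep-view (*ˡ-normed p nf) = loopEntry [] (unlabel p) nf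
entryStep-view (*⇒ _)           = selfLoop []

entryStep-returns : EntryStep e f → f ≢ e → TransClosure _⟶_ f e
entryStep-returns (selfLoop _) f≢e = ⊥-elim (f≢e refl)
entryStep-returns (loopEntry {e₁ = e₁} {e₂ = e₂} hs _ nf) _ with normed⇒reachesOutput nf
... | g , f↝g , g⇒ =
  star-∷ʳ (plug-star hs (plug-star (e₁ ⊛ e₂ ∷ []) f↝g)) (map₂ (plug-step hs ∘ ·⇒→) (hasOutput-sound g⇒))

size-lastFactor-right : Derivative e₂ y → size (lastFactor y) < size (e₁ ⊛ e₂)
size-lastFactor-right d = s≤s (≤-trans (Derivative-lastFactor d) (m≤n+m _ _))

entry-not-body : e —⟨ 𝖾 ⟩→ f → ¬ e —⟨ 𝖻 ⟩→ f
entry-not-body (·→ p)                        (·→ q)          = entry-not-body p q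
entry-not-body (*ˡ-normed {e₁ = e₁} _ _)     (*ʳ q)          =
  <-irrefl refl (size-lastFactor-right {e₁ = e₁} (labelled⇒Derivative q))
entry-not-body (*ˡ-normed _ nf)              (*ˡ-stuck _ ¬nf) = ¬nf nf
entry-not-body (*⇒ {e₁ = e₁} _)              (*ʳ q)          =
  <-irrefl refl (size-lastFactor-right {e₁ = e₁} (labelled⇒Derivative q))

data WithinLoop {n} : SExp n → SExp n → Set where
  withinLoop : ∀ hs → Derivative e₁ g → WithinLoop (plug (e₁ ⊛ e₂) hs) (plug (g ⊙ (e₁ ⊛ e₂)) hs)

avoid⇒withinLoop : Derivative e₁ g →
                   BodyAvoid labelling (plug (e₁ ⊛ e₂) hs) (plug (g ⊙ (e₁ ⊛ e₂)) hs) y →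
                   WithinLoop (plug (e₁ ⊛ e₂) hs) y
avoid⇒withinLoop d here = withinLoop _ d
avoid⇒withinLoop {hs = hs} d (there body w≢x rest)
  with plug-step⁻ (λ ()) hs (proj₂ (unlabel (∈-labelledSteps⁻ _ body)))
... | _ , ·⇒→ _ , refl = ⊥-elim (w≢x refl)
... | _ , ·→ s  , refl = avoid⇒withinLoop (Derivative-step d s) rest

↷⇒withinLoop : _↷_ labelling e f → WithinLoop e f
↷⇒withinLoop {e = e} (_ , entry , v≢e , path) with entryStep-view (∈-labelledSteps⁻ e entry)
... | selfLoop _       = ⊥-elim (v≢e refl)
... | loopEntry _ s _  = avoid⇒withinLoop (step⇒Derivative (proj₂ s)) path

headFactor-plug : ∀ t hs → headFactor {n} (plug t hs) ≡ headFactor t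
headFactor-plug t []       = refl
headFactor-plug t (_ ∷ hs) = headFactor-plug t hs

withinLoop-shrinks : WithinLoop e f → size (headFactor f) < size (headFactor e)
withinLoop-shrinks (withinLoop {e₁ = e₁} {g = g} {e₂ = e₂} hs d) = begin-strict
  size (headFactor (plug (g ⊙ (e₁ ⊛ e₂)) hs))  ≡⟨ cong size (headFactor-plug (g ⊙ (e₁ ⊛ e₂)) hs) ⟩
  size (headFactor g)                          ≤⟨ Derivative-headFactor d ⟩
  size e₁                                      <⟨ s≤s (m≤m+n _ _) ⟩
  size (e₁ ⊛ e₂)                               ≡⟨ cong size (headFactor-plug (e₁ ⊛ e₂) hs) ⟨
  size (headFactor (plug (e₁ ⊛ e₂) hs))        ∎
  where open ≤-Reasoning

withinLoop-noOutput : WithinLoop e f → ¬ (∃ λ a → f ⇒ a)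
withinLoop-noOutput (withinLoop hs _) (_ , f⇒) = plug-noOutput (λ ()) hs f⇒

isLayeringWitness : IsLayeringWitness (labelling {n})
isLayeringWitness = record
  { locallyFinite = λ e → derivatives e , λ _ e↝f → Derivative⇒∈ (Derivative-star self e↝f)
  ; flat          = λ e _ entry body → entry-not-body (∈-labelledSteps⁻ e entry) (∈-labelledSteps⁻ e body)
  ; noBodyCycle   = decreasing⇒acyclic potential (λ {e} body → potential-decreasing (∈-labelledSteps⁻ e body))
  ; entryReturns  = λ e _ entry → entryStep-returns (entryStep-view (∈-labelledSteps⁻ e entry))
  ; layered       = decreasing⇒acyclic (size ∘ headFactor) (withinLoop-shrinks ∘ ↷⇒withinLoop)
  ; gotoFree      = λ _ _ → withinLoop-noOutput ∘ ↷⇒withinLoop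
  }

lemma4p1 : (n : ℕ) → WellLayered (SExpTS n)
lemma4p1 n = labelling , isLayeringWitness
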